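{- Let $V_{\mathsf{now}}$ be a finite set, $\kappa$ a positive integer, and $r_1,\dots,r_m$ elements not in $V_{\mathsf{now}}$ (not necessarily distinct). Let $\hat f$ be a real function on subsets of $V_{\mathsf{now}}\cup\{r_1,\dots,r_m\}$ such that, for every $j$, the restriction of $\hat f$ to $2^{V_{\mathsf{now}}\cup\{r_j\}}$ is non-negative, monotone and submodular. For each $i$ let $A_i\subseteq V_{\mathsf{now}}$ with $|A_i|\le\kappa$ satisfy $\hat f(A_i\cup\{r_i\})=\max_{V'\subseteq V_{\mathsf{now}},|V'|\le\kappa}\hat f(V'\cup\{r_i\})$. Then $$\mathbb{E}_{i,j\sim[m]}[\hat f(A_i\cup\{r_j\})]\ge\frac23\,\mathbb{E}_{i\sim[m]}[\hat f(A_i\cup\{r_i\})],$$ where $i,j\sim[m]$ denotes independent uniform indices in $\{1,\dots,m\}$. -}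

module Defs where

open import Level using (Level; _⊔_) renaming (suc to lsuc)
open import Data.Nat using (ℕ; _≤_; _*_)
open import Data.Fin using (Fin)
open import Data.Fin.Subset using (Subset; _⊆_; _∪_; _∩_; ⁅_⁆; ∣_∣; _∉_)
open import Relation.Binary.Core using (Rel)
open import Relation.Binary.Structures using (IsTotalOrder)
open import Algebra.Bundles using (AbelianGroup)
import Algebra.Definitions.RawMonoid as RM

-- The real numbers (ℝ, +, 0, ≤) are an instance; the paper's real-valued
-- function is replaced by a function valued in an arbitrary such group.
record OrderedAbelianGroup (c ℓ₁ ℓ₂ : Level) : Set (lsuc (c ⊔ ℓ₁ ⊔ ℓ₂)) where
  field
    abelianGroup : AbelianGroup c ℓ₁
  open AbelianGroup abelianGroup public
    renaming (_∙_ to _+_; ε to 0#; _⁻¹ to -_)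
  field
    _≤ᵍ_         : Rel Carrier ℓ₂
    isTotalOrder : IsTotalOrder _≈_ _≤ᵍ_
    +-monoˡ-≤    : ∀ {x y} z → x ≤ᵍ y → (x + z) ≤ᵍ (y + z)

  open RM rawMonoid public using (_×_; sum)

module _ {c ℓ₁ ℓ₂} (G : OrderedAbelianGroup c ℓ₁ ℓ₂) where
  open OrderedAbelianGroup G

  NonNegOn : ∀ {N} → (Subset N → Carrier) → Subset N → Set ℓ₂
  NonNegOn f W = ∀ S → S ⊆ W → 0# ≤ᵍ f S

  MonotoneOn : ∀ {N} → (Subset N → Carrier) → Subset N → Set ℓ₂
  MonotoneOn f W = ∀ S T → S ⊆ W → T ⊆ W → S ⊆ T → f S ≤ᵍ f T

  SubmodularOn : ∀ {N} → (Subset N → Carrier) → Subset N → Set ℓ₂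
  SubmodularOn f W = ∀ S T → S ⊆ W → T ⊆ W →
    (f (S ∪ T) + f (S ∩ T)) ≤ᵍ (f S + f T)

-- Write a_j = f(A_j ∪ {r_j}), α_i = f(A_i) and F_ij = f(A_i ∪ {r_j}).
-- Inside 2^(V_now ∪ {r_j}), submodularity and monotonicity give the exchange
-- a_j + α_i ≤ F_ij + f(A_i ∪ A_j); inside 2^(V_now ∪ {r_k}) they give
-- f(A_i ∪ A_j) + f{r_k} ≤ F_ik + F_jk; and subadditivity gives a_k ≤ α_k + f{r_k}.
-- Chaining, a_j + a_k + α_i ≤ F_ij + F_ik + F_jk + α_k for all i, j, k.
-- Summing over all triples the α-terms cancel, leaving 2m² Σ a ≤ 3m Σ F.
module Submission where

open import Defs
open import Data.Nat using (ℕ; _≤_; _*_; NonZero; zero; suc)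
open import Data.Nat.Properties using (+-identityʳ)
open import Data.Fin using (Fin; zero; suc)
open import Data.Fin.Subset using (Subset; _⊆_; _∪_; _∩_; ⁅_⁆; ∣_∣; _∉_)
open import Data.Fin.Subset.Properties using (p⊆p∪q; q⊆p∪q; p∩q⊆p; x∈p∩q⁺; x∈p∪q⁻; ⊆-trans)
open import Data.Product using (_×_; _,_; proj₁)
open import Data.Sum using (inj₁; inj₂)
open import Relation.Binary.Bundles using (Poset)
open import Relation.Binary.Structures using (IsTotalOrder)
import Algebra.Properties.CommutativeMonoid.Mult as CommutativeMonoidMult
import Algebra.Properties.CommutativeMonoid.Sum as CommutativeMonoidSum
import Algebra.Solver.CommutativeMonoid as CommutativeMonoidSolver
import Relation.Binary.Reasoning.PartialOrder as PosetReasoning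

∪-least : ∀ {n} {p q r : Subset n} → p ⊆ r → q ⊆ r → p ∪ q ⊆ r
∪-least {p = p} {q} p⊆r q⊆r x∈p∪q with x∈p∪q⁻ p q x∈p∪q
... | inj₁ x∈p = p⊆r x∈p
... | inj₂ x∈q = q⊆r x∈q

∩-greatest : ∀ {n} {p q r : Subset n} → r ⊆ p → r ⊆ q → r ⊆ p ∩ q
∩-greatest r⊆p r⊆q x∈r = x∈p∩q⁺ (r⊆p x∈r , r⊆q x∈r)

module OrderedAbelianGroupProperties {c ℓ₁ ℓ₂} (G : OrderedAbelianGroup c ℓ₁ ℓ₂) where
  open OrderedAbelianGroup G renaming (_×_ to _·_)
  open IsTotalOrder isTotalOrder using (total) renaming (refl to ≤-refl)
  open CommutativeMonoidSum commutativeMonoid using (sum-cong-≋; sum-replicate; ∑-distrib-+; ∑-comm)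
  open CommutativeMonoidMult commutativeMonoid using (×-distrib-+; ×-congʳ; ×-congˡ; ×-homo-+)

  poset : Poset c ℓ₁ ℓ₂
  poset = record { isPartialOrder = IsTotalOrder.isPartialOrder isTotalOrder }

  open PosetReasoning poset public

  +-monoʳ-≤ : ∀ {x y} z → x ≤ᵍ y → (z + x) ≤ᵍ (z + y)
  +-monoʳ-≤ {x} {y} z x≤y = begin
    z + x ≈⟨ comm z x ⟩
    x + z ≤⟨ +-monoˡ-≤ z x≤y ⟩
    y + z ≈⟨ comm y z ⟩
    z + y ∎

  +-mono-≤ : ∀ {x y u v} → x ≤ᵍ y → u ≤ᵍ v → (x + u) ≤ᵍ (y + v)
  +-mono-≤ {y = y} {u} x≤y u≤v = begin
    _ + u ≤⟨ +-monoˡ-≤ u x≤y ⟩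
    y + u ≤⟨ +-monoʳ-≤ y u≤v ⟩
    y + _ ∎

  +-cancelʳ-≤ : ∀ {x y} z → (x + z) ≤ᵍ (y + z) → x ≤ᵍ y
  +-cancelʳ-≤ {x} {y} z x+z≤y+z = begin
    x               ≈⟨ sym (+z-z x) ⟩
    (x + z) + (- z) ≤⟨ +-monoˡ-≤ (- z) x+z≤y+z ⟩
    (y + z) + (- z) ≈⟨ +z-z y ⟩
    y               ∎
    where
    +z-z : ∀ w → ((w + z) + (- z)) ≈ w
    +z-z w = trans (assoc w z (- z)) (trans (∙-congˡ (inverseʳ z)) (identityʳ w))

  ×-monoʳ-≤ : ∀ n {x y} → x ≤ᵍ y → (n · x) ≤ᵍ (n · y)
  ×-monoʳ-≤ zero    x≤y = ≤-refl
  ×-monoʳ-≤ (suc n) x≤y = +-mono-≤ x≤y (×-monoʳ-≤ n x≤y)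

  -- Totality is essential: in a partially ordered group n · x ≤ n · y need not imply x ≤ y.
  ×-cancelˡ-≤ : ∀ n .{{_ : NonZero n}} {x y} → (n · x) ≤ᵍ (n · y) → x ≤ᵍ y
  ×-cancelˡ-≤ (suc n) {x} {y} nx≤ny with total x y
  ... | inj₁ x≤y = x≤y
  ... | inj₂ y≤x = +-cancelʳ-≤ (n · x) (begin
    x + n · x ≤⟨ nx≤ny ⟩
    y + n · y ≤⟨ +-monoʳ-≤ y (×-monoʳ-≤ n y≤x) ⟩
    y + n · x ∎)

  ∑-mono-≤ : ∀ {n} {u v : Fin n → Carrier} → (∀ i → u i ≤ᵍ v i) → sum u ≤ᵍ sum v
  ∑-mono-≤ {zero}  u≤v = ≤-refl
  ∑-mono-≤ {suc n} u≤v = +-mono-≤ (u≤v zero) (∑-mono-≤ (λ i → u≤v (suc i)))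

  ∑-×ʳ : ∀ {n} k (u : Fin n → Carrier) → sum (λ i → k · u i) ≈ (k · sum u)
  ∑-×ʳ {n} k u = begin-equality
    sum {n} (λ i → k · u i)             ≈⟨ sum-cong-≋ (λ i → sym (sum-replicate k {u i})) ⟩
    sum {n} (λ i → sum {k} (λ _ → u i)) ≈⟨ ∑-comm {n} {k} (λ i _ → u i) ⟩
    sum {k} (λ _ → sum u)               ≈⟨ sum-replicate k {sum u} ⟩
    k · sum u                           ∎

  ×-double : ∀ n x → ((2 * n) · x) ≈ ((n · x) + (n · x))
  ×-double n x = trans (×-homo-+ x n _) (∙-congˡ (×-congˡ (+-identityʳ n)))

  ×-triple : ∀ x → (3 · x) ≈ ((x + x) + x)
  ×-triple x = trans (∙-congˡ (∙-congˡ (identityʳ x))) (sym (assoc x x x))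

  ∑² : ∀ {m} → (Fin m → Fin m → Carrier) → Carrier
  ∑² F = sum λ i → sum λ j → F i j

  module Cube (m : ℕ) where

    ∑³ : (Fin m → Fin m → Fin m → Carrier) → Carrier
    ∑³ h = sum λ i → sum λ j → sum λ k → h i j k

    ∑²-const₁ : ∀ u → ∑² {m} (λ i j → u j) ≈ (m · sum u)
    ∑²-const₁ u = sum-replicate m {sum u}

    ∑²-const₂ : ∀ u → ∑² {m} (λ i j → u i) ≈ (m · sum u)
    ∑²-const₂ u = trans (sum-cong-≋ {m} λ i → sum-replicate m {u i}) (∑-×ʳ m u)

    ∑³-const₁ : ∀ F → ∑³ (λ i j k → F j k) ≈ (m · ∑² F)
    ∑³-const₁ F = sum-replicate m {∑² F}

    ∑³-const₂ : ∀ F → ∑³ (λ i j k → F i k) ≈ (m · ∑² F)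
    ∑³-const₂ F = trans (sum-cong-≋ {m} λ i → sum-replicate m {sum (F i)}) (∑-×ʳ m (λ i → sum (F i)))

    ∑³-const₃ : ∀ F → ∑³ (λ i j k → F i j) ≈ (m · ∑² F)
    ∑³-const₃ F =
      trans (sum-cong-≋ {m} λ i → trans (sum-cong-≋ {m} λ j → sum-replicate m {F i j}) (∑-×ʳ m (F i)))
            (∑-×ʳ m (λ i → sum (F i)))

    ∑³-distrib-+ : ∀ g h → ∑³ (λ i j k → g i j k + h i j k) ≈ (∑³ g + ∑³ h)
    ∑³-distrib-+ g h = trans
      (sum-cong-≋ {m} λ i → trans (sum-cong-≋ {m} λ j → ∑-distrib-+ (g i j) (h i j))
                                  (∑-distrib-+ (λ j → sum (g i j)) (λ j → sum (h i j))))
      (∑-distrib-+ (λ i → ∑² (g i)) (λ i → ∑² (h i)))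

    ∑³-mono-≤ : ∀ {g h} → (∀ i j k → g i j k ≤ᵍ h i j k) → ∑³ g ≤ᵍ ∑³ h
    ∑³-mono-≤ g≤h = ∑-mono-≤ λ i → ∑-mono-≤ λ j → ∑-mono-≤ λ k → g≤h i j k

  triangle-averaging : ∀ m .{{_ : NonZero m}} (a α : Fin m → Carrier) (F : Fin m → Fin m → Carrier) →
    (∀ i j k → ((a j + a k) + α i) ≤ᵍ (((F i j + F i k) + F j k) + α k)) →
    ((2 * m) · sum a) ≤ᵍ (3 · ∑² F)
  triangle-averaging m a α F triangle = ×-cancelˡ-≤ m (begin
    m · ((2 * m) · Σa)            ≈⟨ ×-congʳ m (×-double m Σa) ⟩
    m · (m · Σa + m · Σa)         ≈⟨ ×-distrib-+ (m · Σa) (m · Σa) m ⟩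
    m · (m · Σa) + m · (m · Σa)   ≤⟨ +-cancelʳ-≤ (m · (m · Σα)) summed ⟩
    (m · X + m · X) + m · X       ≈⟨ sym m·[X+X+X] ⟩
    m · ((X + X) + X)             ≈⟨ ×-congʳ m (sym (×-triple X)) ⟩
    m · (3 · X)                   ∎)
    where
    open Cube m

    Σa Σα X : Carrier
    Σa = sum a
    Σα = sum α
    X = ∑² F

    m·[X+X+X] : (m · ((X + X) + X)) ≈ ((m · X + m · X) + m · X)
    m·[X+X+X] = trans (×-distrib-+ (X + X) X m) (∙-congʳ (×-distrib-+ X X m))

    summed : ((m · (m · Σa) + m · (m · Σa)) + m · (m · Σα))
          ≤ᵍ (((m · X + m · X) + m · X) + m · (m · Σα))
    summed = begin
      (m · (m · Σa) + m · (m · Σa)) + m · (m · Σα)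
        ≈⟨ sym (∙-cong (∙-cong (trans (∑³-const₃ _) (×-congʳ m (∑²-const₁ a)))
                               (trans (∑³-const₁ _) (×-congʳ m (∑²-const₁ a))))
                       (trans (∑³-const₃ _) (×-congʳ m (∑²-const₂ α)))) ⟩
      (∑³ (λ i j k → a j) + ∑³ (λ i j k → a k)) + ∑³ (λ i j k → α i)
        ≈⟨ sym (trans (∑³-distrib-+ _ _) (∙-congʳ (∑³-distrib-+ _ _))) ⟩
      ∑³ (λ i j k → (a j + a k) + α i)
        ≤⟨ ∑³-mono-≤ triangle ⟩
      ∑³ (λ i j k → ((F i j + F i k) + F j k) + α k)
        ≈⟨ trans (∑³-distrib-+ _ _) (∙-congʳ (trans (∑³-distrib-+ _ _) (∙-congʳ (∑³-distrib-+ _ _)))) ⟩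
      ((∑³ (λ i j k → F i j) + ∑³ (λ i j k → F i k)) + ∑³ (λ i j k → F j k)) + ∑³ (λ i j k → α k)
        ≈⟨ ∙-cong (∙-cong (∙-cong (∑³-const₃ F) (∑³-const₂ F)) (∑³-const₁ F))
                  (trans (∑³-const₁ _) (×-congʳ m (∑²-const₁ α))) ⟩
      ((m · X + m · X) + m · X) + m · (m · Σα)
        ∎

module SetFunctionProperties {c ℓ₁ ℓ₂} (G : OrderedAbelianGroup c ℓ₁ ℓ₂) {N : ℕ}
  (f : Subset N → OrderedAbelianGroup.Carrier G) {W : Subset N} where
  open OrderedAbelianGroup G
  open OrderedAbelianGroupProperties G

  submodular-≤ : MonotoneOn G f W → SubmodularOn G f W →
    ∀ {S T P Q} → S ⊆ W → T ⊆ W → P ⊆ S ∪ T → Q ⊆ S ∩ T →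
    (f P + f Q) ≤ᵍ (f S + f T)
  submodular-≤ mono sub {S} {T} {P} {Q} S⊆W T⊆W P⊆S∪T Q⊆S∩T = begin
    f P + f Q             ≤⟨ +-mono-≤ (mono P (S ∪ T) (⊆-trans P⊆S∪T S∪T⊆W) S∪T⊆W P⊆S∪T)
                                      (mono Q (S ∩ T) (⊆-trans Q⊆S∩T S∩T⊆W) S∩T⊆W Q⊆S∩T) ⟩
    f (S ∪ T) + f (S ∩ T) ≤⟨ sub S T S⊆W T⊆W ⟩
    f S + f T             ∎
    where
    S∪T⊆W = ∪-least S⊆W T⊆W
    S∩T⊆W = ⊆-trans (p∩q⊆p S T) S⊆W

  subadditive : NonNegOn G f W → SubmodularOn G f W →
    ∀ {S T} → S ⊆ W → T ⊆ W → f (S ∪ T) ≤ᵍ (f S + f T)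
  subadditive nonneg sub {S} {T} S⊆W T⊆W = begin
    f (S ∪ T)             ≈⟨ sym (identityʳ (f (S ∪ T))) ⟩
    f (S ∪ T) + 0#        ≤⟨ +-monoʳ-≤ (f (S ∪ T)) (nonneg (S ∩ T) (⊆-trans (p∩q⊆p S T) S⊆W)) ⟩
    f (S ∪ T) + f (S ∩ T) ≤⟨ sub S T S⊆W T⊆W ⟩
    f S + f T             ∎

module CommonGroundSet {c ℓ₁ ℓ₂} (G : OrderedAbelianGroup c ℓ₁ ℓ₂) {N m : ℕ}
  (Vnow : Subset N) (r : Fin m → Fin N) (f : Subset N → OrderedAbelianGroup.Carrier G)
  (hyp : ∀ j → NonNegOn G f (Vnow ∪ ⁅ r j ⁆)
             × MonotoneOn G f (Vnow ∪ ⁅ r j ⁆)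
             × SubmodularOn G f (Vnow ∪ ⁅ r j ⁆))
  (A : Fin m → Subset N) (A⊆Vnow : ∀ i → A i ⊆ Vnow) where
  open OrderedAbelianGroup G
  open OrderedAbelianGroupProperties G
  open SetFunctionProperties G f
  open CommutativeMonoidSolver commutativeMonoid using (solve; _⊕_; _⊜_)

  W : Fin m → Subset N
  W j = Vnow ∪ ⁅ r j ⁆

  F : Fin m → Fin m → Carrier
  F i j = f (A i ∪ ⁅ r j ⁆)

  A⊆W : ∀ i j → A i ⊆ W j
  A⊆W i j = ⊆-trans (A⊆Vnow i) (p⊆p∪q _)

  A∪r⊆W : ∀ i j → A i ∪ ⁅ r j ⁆ ⊆ W j
  A∪r⊆W i j = ∪-least (A⊆W i j) (q⊆p∪q Vnow _)

  exchange : ∀ i j → (F j j + f (A i)) ≤ᵍ (F i j + f (A i ∪ A j))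
  exchange i j with hyp j
  ... | _ , mono , sub = submodular-≤ mono sub (A∪r⊆W i j) (∪-least (A⊆W i j) (A⊆W j j))
    (∪-least (⊆-trans (q⊆p∪q (A i) (A j)) (q⊆p∪q _ _)) (⊆-trans (q⊆p∪q (A i) _) (p⊆p∪q _)))
    (∩-greatest (p⊆p∪q _) (p⊆p∪q _))

  merge : ∀ i j k → (f (A i ∪ A j) + f ⁅ r k ⁆) ≤ᵍ (F i k + F j k)
  merge i j k with hyp k
  ... | _ , mono , sub = submodular-≤ mono sub (A∪r⊆W i k) (A∪r⊆W j k)
    (∪-least (⊆-trans (p⊆p∪q _) (p⊆p∪q _)) (⊆-trans (p⊆p∪q _) (q⊆p∪q _ _)))
    (∩-greatest (q⊆p∪q (A i) _) (q⊆p∪q (A j) _))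

  split : ∀ k → F k k ≤ᵍ (f (A k) + f ⁅ r k ⁆)
  split k with hyp k
  ... | nonneg , _ , sub = subadditive nonneg sub (A⊆W k k) (q⊆p∪q Vnow _)

  triangle : ∀ i j k → ((F j j + F k k) + f (A i)) ≤ᵍ (((F i j + F i k) + F j k) + f (A k))
  triangle i j k = begin
    (F j j + F k k) + f (A i)
      ≈⟨ solve 3 (λ x y z → (x ⊕ y) ⊕ z ⊜ (x ⊕ z) ⊕ y) refl (F j j) (F k k) (f (A i)) ⟩
    (F j j + f (A i)) + F k k
      ≤⟨ +-mono-≤ (exchange i j) (split k) ⟩
    (F i j + f (A i ∪ A j)) + (f (A k) + f ⁅ r k ⁆)
      ≈⟨ solve 4 (λ x u y z → (x ⊕ u) ⊕ (y ⊕ z) ⊜ x ⊕ ((u ⊕ z) ⊕ y))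
               refl (F i j) (f (A i ∪ A j)) (f (A k)) (f ⁅ r k ⁆) ⟩
    F i j + ((f (A i ∪ A j) + f ⁅ r k ⁆) + f (A k))
      ≤⟨ +-monoʳ-≤ (F i j) (+-monoˡ-≤ (f (A k)) (merge i j k)) ⟩
    F i j + ((F i k + F j k) + f (A k))
      ≈⟨ solve 4 (λ x y z w → x ⊕ ((y ⊕ z) ⊕ w) ⊜ ((x ⊕ y) ⊕ z) ⊕ w)
               refl (F i j) (F i k) (F j k) (f (A k)) ⟩
    ((F i j + F i k) + F j k) + f (A k)
      ∎

lemma4 : ∀ {c ℓ₁ ℓ₂} (G : OrderedAbelianGroup c ℓ₁ ℓ₂) →
    let open OrderedAbelianGroup G renaming (_×_ to _·_) in
    (N : ℕ) (Vnow : Subset N) (κ m : ℕ) → .{{NonZero κ}} → .{{NonZero m}} →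
    (r : Fin m → Fin N) → (∀ j → r j ∉ Vnow) →
    (f : Subset N → Carrier) →
    (∀ j → NonNegOn G f (Vnow ∪ ⁅ r j ⁆)
         × MonotoneOn G f (Vnow ∪ ⁅ r j ⁆)
         × SubmodularOn G f (Vnow ∪ ⁅ r j ⁆)) →
    (A : Fin m → Subset N) →
    (∀ i → A i ⊆ Vnow × ∣ A i ∣ ≤ κ) →
    (∀ i (V′ : Subset N) → V′ ⊆ Vnow → ∣ V′ ∣ ≤ κ →
       f (V′ ∪ ⁅ r i ⁆) ≤ᵍ f (A i ∪ ⁅ r i ⁆)) →
    ((2 * m) · sum (λ i → f (A i ∪ ⁅ r i ⁆)))
      ≤ᵍ (3 · sum (λ i → sum (λ j → f (A i ∪ ⁅ r j ⁆))))
lemma4 G N Vnow κ m r _ f hyp A A-feasible _ =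
  triangle-averaging m (λ j → F j j) (λ i → f (A i)) F triangle
  where
  open OrderedAbelianGroupProperties G using (triangle-averaging)
  open CommonGroundSet G Vnow r f hyp A (λ i → proj₁ (A-feasible i))
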